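{- Let $p$ be an odd prime, $l\ge 0$, $m\ge1$ an odd integer coprime to $p$, $n\ge 2$, $N=2^n\times m\times p^l$, and $a$ an integer coprime to $N$. Assume that the $(2a+2^nm\mathbb{Z})$-monomial minimal solution of $(E_{2^nm})$ is irreducible, and that there exists $2\le b\le n$ such that the $(2a+2^bp\mathbb{Z})$-monomial minimal solution of $(E_{2^bp})$ is irreducible. Then the $\overline{2a}$-monomial minimal solution of $(E_N)$ is irreducible. In particular, if there exists $2\le b\le n$ such that $2^nm$ and $2^bp$ are both semi monomially irreducible, then $N$ is semi monomially irreducible.
   Context: For an integer $N\ge 2$ and $a_1,\dots,a_n\in\mathbb{Z}/N\mathbb{Z}$, set $M_n(a_1,\dots,a_n)=\begin{pmatrix}a_n&-1\\1&0\end{pmatrix}\cdots\begin{pmatrix}a_1&-1\\1&0\end{pmatrix}\in SL_2(\mathbb{Z}/N\mathbb{Z})$. The equation $(E_N)$ is $M_n(a_1,\dots,a_n)=\pm \mathrm{Id}$; an $n$-tuple satisfying it is a solution of size $n$. Define $(a_1,\dots,a_n)\oplus(b_1,\dots,b_m)=(a_1+b_m,a_2,\dots,a_{n-1},a_n+b_1,b_2,\dots,b_{m-1})$, and $(a_1,\dots,a_n)\sim(b_1,\dots,b_n)$ if $(b_1,\dots,b_n)$ is a cyclic permutation of $(a_1,\dots,a_n)$ or of $(a_n,\dots,a_1)$. A solution $(c_1,\dots,c_n)$ of $(E_N)$ with $n\ge 3$ is reducible if there exist a solution $(b_1,\dots,b_l)$ of $(E_N)$ and an $m$-tuple $(a_1,\dots,a_m)$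 with $m\ge3$, $l\ge 3$ and $(c_1,\dots,c_n)\sim(a_1,\dots,a_m)\oplus(b_1,\dots,b_l)$; otherwise irreducible ($(\overline0,\overline0)$ is not irreducible). The $\overline k$-monomial minimal solution of $(E_N)$ is $(\overline k,\dots,\overline k)$ of the least positive length for which it solves $(E_N)$. Semi monomial irreducibility: if $N$ is odd or divisible by $4$, $N$ is semi monomially irreducible if for every integer $a$ coprime to $N$ the $\overline{2a}$-monomial minimal solution of $(E_N)$ is irreducible; if $N$ is even and not divisible by $4$, the same is required for every integer $a$ coprime to $N/2$. -}

module Defs where

open import Data.Nat as ℕ using (ℕ; zero; suc; _≤_; _<_; _∸_)
open import Data.Nat.DivMod using (_/_)
open import Data.Nat.Divisibility as ℕD using ()
open import Data.Integer as ℤ using (ℤ; +_; _+_; _-_; _*_; -_; 0ℤ; 1ℤ)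
open import Data.Integer.Divisibility using (_∣_)
open import Data.Integer.Coprimality using (Coprime)
open import Data.List using (List; []; _∷_; _++_; [_]; length; replicate; take; drop; reverse; foldl; last)
open import Data.List.Relation.Binary.Pointwise using (Pointwise)
open import Data.Maybe using (fromMaybe)
open import Data.Product using (Σ; ∃; _×_; _,_)
open import Data.Sum using (_⊎_)
open import Relation.Nullary using (¬_)

_≡_[mod_] : ℤ → ℤ → ℕ → Set
x ≡ y [mod N ] = (+ N) ∣ (x - y)

record Mat : Set where
  constructor mat
  field
    m11 m12 m21 m22 : ℤ

_⊗_ : Mat → Mat → Mat
mat a b c d ⊗ mat e f g h = mat (a * e + b * g) (a * f + b * h) (c * e + d * g) (c * f + d * h)

Id : Mat
Id = mat 1ℤ 0ℤ 0ℤ 1ℤ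

Mk : ℤ → Mat
Mk a = mat a (- 1ℤ) 1ℤ 0ℤ

-- M_n(a_1,…,a_n) = Mk a_n ⋯ Mk a_1
Mn : List ℤ → Mat
Mn = foldl (λ M a → Mk a ⊗ M) Id

MatEqMod : ℕ → Mat → Mat → Set
MatEqMod N (mat a b c d) (mat e f g h) =
  (a ≡ e [mod N ]) × (b ≡ f [mod N ]) × (c ≡ g [mod N ]) × (d ≡ h [mod N ])

Solution : ℕ → List ℤ → Set
Solution N as = MatEqMod N (Mn as) Id ⊎ MatEqMod N (Mn as) (mat (- 1ℤ) 0ℤ 0ℤ (- 1ℤ))

hd : List ℤ → ℤ
hd [] = 0ℤ
hd (x ∷ _) = x

lst : List ℤ → ℤ
lst xs = fromMaybe 0ℤ (last xs)

inner : List ℤ → List ℤ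
inner xs = drop 1 (take (length xs ∸ 1) xs)

-- (a_1,…,a_n) ⊕ (b_1,…,b_m) = (a_1+b_m, a_2,…,a_{n-1}, a_n+b_1, b_2,…,b_{m-1})
-- (only used for n, m ≥ 3)
_⊕_ : List ℤ → List ℤ → List ℤ
as ⊕ bs = [ hd as + lst bs ] ++ inner as ++ [ lst as + hd bs ] ++ inner bs

rotate : ℕ → List ℤ → List ℤ
rotate k xs = drop k xs ++ take k xs

_≋_[mod_] : List ℤ → List ℤ → ℕ → Set
xs ≋ ys [mod N ] = Pointwise (λ x y → x ≡ y [mod N ]) xs ys

Equiv : ℕ → List ℤ → List ℤ → Set
Equiv N xs ys =
  Σ ℕ λ k → k < length ys ×
    ((xs ≋ rotate k ys [mod N ]) ⊎ (xs ≋ rotate k (reverse ys) [mod N ]))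

Reducible : ℕ → List ℤ → Set
Reducible N cs =
  Σ (List ℤ) λ bs → Σ (List ℤ) λ as →
    Solution N bs × 3 ≤ length bs × 3 ≤ length as × Equiv N cs (as ⊕ bs)

Irreducible : ℕ → List ℤ → Set
Irreducible N cs = Solution N cs × 3 ≤ length cs × ¬ Reducible N cs

IsMonomialMinimalLength : ℕ → ℤ → ℕ → Set
IsMonomialMinimalLength N k n =
  1 ≤ n × Solution N (replicate n k) ×
  ((j : ℕ) → 1 ≤ j → j < n → ¬ Solution N (replicate j k))

MonomialMinimalIrreducible : ℕ → ℤ → Set
MonomialMinimalIrreducible N k =
  (n : ℕ) → IsMonomialMinimalLength N k n → Irreducible N (replicate n k)

SemiMonomiallyIrreducible : ℕ → Set
SemiMonomiallyIrreducible N =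
  ((¬ (2 ℕD.∣ N) ⊎ 4 ℕD.∣ N) →
     (a : ℤ) → Coprime a (+ N) → MonomialMinimalIrreducible N (2ℤ * a)) ×
  ((2 ℕD.∣ N × ¬ (4 ℕD.∣ N)) →
     (a : ℤ) → Coprime a (+ (N / 2)) → MonomialMinimalIrreducible N (2ℤ * a))
  where
    2ℤ : ℤ
    2ℤ = + 2

{-# OPTIONS --safe #-}
-- Put k = 2a and let u be the sequence with M_L(k, …, k) = [[u (2+L), -u (1+L)], [u (1+L), -u L]].
-- Modulo any Q the constant tuple of length n is reducible exactly when u (2+L) ≡ ±1 for some
-- 1 ≤ L ≤ n - 3, a decomposition being (k - x, k, …, k, k - x) ⊕ (x, k, …, k, x) with x = ±u (1+L).
-- Since u is quasi-periodic modulo Q with the minimal length as period, irreducibility of the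
-- minimal solution modulo Q forces u (1+L) ≡ 0 or u (3+L) ≡ 0 whenever u (2+L) ≡ ±1.
-- Suppose the minimal solution modulo N = 2ⁿ m pˡ were reducible and apply this to Q = 2ⁿ m and to
-- Q = 2ᵇ p. The neighbours satisfy u (1+L) + u (3+L) = k u (2+L), divisible neither by 4 nor by p,
-- and u (1+L) u (3+L) = u (2+L)² - 1 ≡ 0 modulo N. Hence the same neighbour vanishes modulo both
-- moduli while the other is prime to p, so pˡ divides the first one, which then vanishes modulo N:
-- a monomial solution modulo N shorter than the minimal one.
module Submission where

open import Defs

module Congruence where

  open import Data.Nat as ℕ using (ℕ)
  open import Data.Nat.Divisibility as ℕ using (∣-trans)
  open import Data.Integer using (ℤ; +_; _+_; _-_; _*_; -_; 0ℤ)
  import Data.Integer.Divisibility.Signed as Signed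
  open Signed using (divides; ∣ᵤ⇒∣; ∣⇒∣ᵤ; ∣m∣n⇒∣m+n; ∣m⇒∣-m; ∣n⇒∣m*n; ∣m⇒∣m*n)
  open import Data.Integer.Tactic.RingSolver using (solve-∀)
  open import Level using (0ℓ)
  open import Relation.Binary.Bundles using (Setoid)
  open import Relation.Binary.PropositionalEquality using (_≡_; refl)

  -- x ≡ y [mod Q ] unfolds to divisibility of ∣ x - y ∣, from which unification cannot
  -- recover x and y; this wrapper keeps them visible.
  infix 4 _≈_[mod_]
  record _≈_[mod_] (x y : ℤ) (Q : ℕ) : Set where
    constructor mod
    field unmod : x ≡ y [mod Q ]
  open _≈_[mod_] public

  private
    by-signed : ∀ {Q x y z} → z ≡ x - y → + Q Signed.∣ z → x ≈ y [mod Q ]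
    by-signed refl h = mod (∣⇒∣ᵤ h)

    signed : ∀ {Q x y} → x ≈ y [mod Q ] → + Q Signed.∣ (x - y)
    signed (mod h) = ∣ᵤ⇒∣ h

  ≈-refl : ∀ {Q x} → x ≈ x [mod Q ]
  ≈-refl {Q} {x} = by-signed (cancel x (+ Q)) (divides 0ℤ refl)
    where
    cancel : ∀ x q → 0ℤ * q ≡ x - x
    cancel = solve-∀

  ≡⇒≈ : ∀ {Q x y} → x ≡ y → x ≈ y [mod Q ]
  ≡⇒≈ refl = ≈-refl

  ≈-sym : ∀ {Q x y} → x ≈ y [mod Q ] → y ≈ x [mod Q ]
  ≈-sym {x = x} {y} h = by-signed (negate x y) (∣m⇒∣-m (signed h))
    where
    negate : ∀ x y → - (x - y) ≡ y - x
    negate = solve-∀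

  ≈-trans : ∀ {Q x y z} → x ≈ y [mod Q ] → y ≈ z [mod Q ] → x ≈ z [mod Q ]
  ≈-trans {x = x} {y} {z} h h′ = by-signed (telescope x y z) (∣m∣n⇒∣m+n (signed h) (signed h′))
    where
    telescope : ∀ x y z → (x - y) + (y - z) ≡ x - z
    telescope = solve-∀

  +-cong-mod : ∀ {Q x x′ y y′} → x ≈ x′ [mod Q ] → y ≈ y′ [mod Q ] → x + y ≈ x′ + y′ [mod Q ]
  +-cong-mod {x = x} {x′} {y} {y′} h h′ =
    by-signed (regroup x x′ y y′) (∣m∣n⇒∣m+n (signed h) (signed h′))
    where
    regroup : ∀ x x′ y y′ → (x - x′) + (y - y′) ≡ (x + y) - (x′ + y′)
    regroup = solve-∀

  *-cong-mod : ∀ {Q x x′ y y′} → x ≈ x′ [mod Q ] → y ≈ y′ [mod Q ] → x * y ≈ x′ * y′ [mod Q ]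
  *-cong-mod {x = x} {x′} {y} {y′} h h′ =
    by-signed (regroup x x′ y y′) (∣m∣n⇒∣m+n (∣m⇒∣m*n y (signed h)) (∣n⇒∣m*n x′ (signed h′)))
    where
    regroup : ∀ x x′ y y′ → (x - x′) * y + x′ * (y - y′) ≡ x * y - x′ * y′
    regroup = solve-∀

  -‿cong-mod : ∀ {Q x y} → x ≈ y [mod Q ] → - x ≈ - y [mod Q ]
  -‿cong-mod {x = x} {y} h = by-signed (negate x y) (∣m⇒∣-m (signed h))
    where
    negate : ∀ x y → - (x - y) ≡ - x - - y
    negate = solve-∀

  *-congˡ-mod : ∀ {Q} x {y y′} → y ≈ y′ [mod Q ] → x * y ≈ x * y′ [mod Q ]
  *-congˡ-mod x = *-cong-mod (≈-refl {x = x})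

  *-congʳ-mod : ∀ {Q} y {x x′} → x ≈ x′ [mod Q ] → x * y ≈ x′ * y [mod Q ]
  *-congʳ-mod y h = *-cong-mod h (≈-refl {x = y})

  +-congʳ-mod : ∀ {Q} y {x x′} → x ≈ x′ [mod Q ] → x + y ≈ x′ + y [mod Q ]
  +-congʳ-mod y h = +-cong-mod h (≈-refl {x = y})

  ≈-∣ : ∀ {d Q x y} → d ℕ.∣ Q → x ≈ y [mod Q ] → x ≈ y [mod d ]
  ≈-∣ d∣Q (mod h) = mod (∣-trans d∣Q h)

  ≈-setoid : ℕ → Setoid 0ℓ 0ℓ
  ≈-setoid Q = record
    { Carrier = ℤ
    ; _≈_ = _≈_[mod Q ]
    ; isEquivalence = record { refl = ≈-refl ; sym = ≈-sym ; trans = ≈-trans }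
    }

  module ≈-Reasoning (Q : ℕ) where
    open import Relation.Binary.Reasoning.Setoid (≈-setoid Q) public

module Matrices where

  open Congruence
  open import Data.Nat as ℕ using (ℕ)
  open import Data.Nat.Divisibility as ℕ using (∣-trans; _∣?_)
  open import Data.Integer using (ℤ; _+_; _-_; _*_; -_; 0ℤ; 1ℤ; ∣_∣)
  open import Data.Integer.Tactic.RingSolver using (solve-∀)
  open import Data.List using ([]; _∷_; _++_; [_]; foldl)
  open import Data.List.Properties using (foldl-++)
  open import Data.List.Relation.Binary.Pointwise using ([]; _∷_)
  open import Data.Product using (Σ; _,_)
  open import Data.Sign as Sign using (Sign)
  open import Data.Sum using (inj₁; inj₂)
  open import Level using (0ℓ)
  open import Relation.Binary.Bundles using (Setoid)
  open import Relation.Nullary.Decidable using (Dec; _×-dec_; _⊎-dec_)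
  open import Relation.Binary.PropositionalEquality hiding ([_])
  open ≡-Reasoning

  mat-cong : ∀ {a b c d e f g h} → a ≡ e → b ≡ f → c ≡ g → d ≡ h → mat a b c d ≡ mat e f g h
  mat-cong refl refl refl refl = refl

  ⊗-assoc : ∀ M P R → (M ⊗ P) ⊗ R ≡ M ⊗ (P ⊗ R)
  ⊗-assoc (mat a b c d) (mat e f g h) (mat i j k l) =
    mat-cong (row-col a b e f g h i k) (row-col a b e f g h j l)
             (row-col c d e f g h i k) (row-col c d e f g h j l)
    where
    row-col : ∀ (a b e f g h i k : ℤ) →
              (a * e + b * g) * i + (a * f + b * h) * k ≡ a * (e * i + f * k) + b * (g * i + h * k)
    row-col = solve-∀

  ⊗-identityˡ : ∀ M → Id ⊗ M ≡ M
  ⊗-identityˡ (mat a b c d) = mat-cong (first a c) (first b d) (second a c) (second b d)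
    where
    first : ∀ (x y : ℤ) → 1ℤ * x + 0ℤ * y ≡ x
    first = solve-∀
    second : ∀ (x y : ℤ) → 0ℤ * x + 1ℤ * y ≡ y
    second = solve-∀

  ⊗-identityʳ : ∀ M → M ⊗ Id ≡ M
  ⊗-identityʳ (mat a b c d) = mat-cong (first a b) (second a b) (first c d) (second c d)
    where
    first : ∀ (x y : ℤ) → x * 1ℤ + y * 0ℤ ≡ x
    first = solve-∀
    second : ∀ (x y : ℤ) → x * 0ℤ + y * 1ℤ ≡ y
    second = solve-∀

  Mk-⊗ : ∀ z a b c d → Mk z ⊗ mat a b c d ≡ mat (z * a - c) (z * b - d) a b
  Mk-⊗ z a b c d = mat-cong (top z a c) (top z b d) (bottom a c) (bottom b d)
    where
    top : ∀ (z x y : ℤ) → z * x + - 1ℤ * y ≡ z * x - y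
    top = solve-∀
    bottom : ∀ (x y : ℤ) → 1ℤ * x + 0ℤ * y ≡ x
    bottom = solve-∀

  ⊗-Mk : ∀ a b c d x → mat a b c d ⊗ Mk x ≡ mat (a * x + b) (- a) (c * x + d) (- c)
  ⊗-Mk a b c d x = mat-cong (left a b x) (right a b) (left c d x) (right c d)
    where
    left : ∀ (a b x : ℤ) → a * x + b * 1ℤ ≡ a * x + b
    left = solve-∀
    right : ∀ (a b : ℤ) → a * - 1ℤ + b * 0ℤ ≡ - a
    right = solve-∀

  m22-Mk-sandwich : ∀ z P x → Mat.m22 (Mk z ⊗ (P ⊗ Mk x)) ≡ - Mat.m11 P
  m22-Mk-sandwich z (mat a b c d) x =
    cong Mat.m22 (trans (cong (Mk z ⊗_) (⊗-Mk a b c d x)) (Mk-⊗ z _ _ _ _))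

  -- The middle matrix is -σ (Mk y)⁻².
  Mk-sandwich-scaled : ∀ σ y → Mk y ⊗ (mat σ (- (σ * y)) (σ * y) (σ * (1ℤ - y * y)) ⊗ Mk y)
                               ≡ mat (- σ) 0ℤ 0ℤ (- σ)
  Mk-sandwich-scaled σ y = begin
    Mk y ⊗ (mat σ (- (σ * y)) (σ * y) (σ * (1ℤ - y * y)) ⊗ Mk y)
      ≡⟨ cong (Mk y ⊗_) (⊗-Mk _ _ _ _ y) ⟩
    Mk y ⊗ mat (σ * y + - (σ * y)) (- σ) (σ * y * y + σ * (1ℤ - y * y)) (- (σ * y))
      ≡⟨ Mk-⊗ y _ _ _ _ ⟩
    mat (y * (σ * y + - (σ * y)) - (σ * y * y + σ * (1ℤ - y * y))) (y * - σ - - (σ * y))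
        (σ * y + - (σ * y)) (- σ)
      ≡⟨ mat-cong (e₁₁ σ y) (e₁₂ σ y) (e₂₁ σ y) refl ⟩
    mat (- σ) 0ℤ 0ℤ (- σ)
      ∎
    where
    e₁₁ : ∀ σ y → y * (σ * y + - (σ * y)) - (σ * y * y + σ * (1ℤ - y * y)) ≡ - σ
    e₁₁ = solve-∀
    e₁₂ : ∀ σ y → y * - σ - - (σ * y) ≡ 0ℤ
    e₁₂ = solve-∀
    e₂₁ : ∀ σ y → σ * y + - (σ * y) ≡ 0ℤ
    e₂₁ = solve-∀

  foldl-Mk : ∀ xs M → foldl (λ M a → Mk a ⊗ M) M xs ≡ Mn xs ⊗ M
  foldl-Mk [] M = sym (⊗-identityˡ M)
  foldl-Mk (x ∷ xs) M = begin
    foldl (λ M a → Mk a ⊗ M) (Mk x ⊗ M) xs ≡⟨ foldl-Mk xs (Mk x ⊗ M) ⟩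
    Mn xs ⊗ (Mk x ⊗ M)                     ≡⟨ cong (λ P → Mn xs ⊗ (P ⊗ M)) (⊗-identityʳ (Mk x)) ⟨
    Mn xs ⊗ ((Mk x ⊗ Id) ⊗ M)              ≡⟨ ⊗-assoc (Mn xs) (Mk x ⊗ Id) M ⟨
    (Mn xs ⊗ (Mk x ⊗ Id)) ⊗ M              ≡⟨ cong (_⊗ M) (foldl-Mk xs (Mk x ⊗ Id)) ⟨
    Mn (x ∷ xs) ⊗ M                        ∎

  Mn-++ : ∀ xs ys → Mn (xs ++ ys) ≡ Mn ys ⊗ Mn xs
  Mn-++ xs ys = trans (foldl-++ _ Id xs ys) (foldl-Mk ys (Mn xs))

  Mn-ends : ∀ x ys z → Mn (x ∷ ys ++ [ z ]) ≡ Mk z ⊗ (Mn ys ⊗ Mk x)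
  Mn-ends x ys z = begin
    Mn ([ x ] ++ ys ++ [ z ])     ≡⟨ Mn-++ [ x ] (ys ++ [ z ]) ⟩
    Mn (ys ++ [ z ]) ⊗ Mn [ x ]   ≡⟨ cong (_⊗ Mn [ x ]) (Mn-++ ys [ z ]) ⟩
    (Mn [ z ] ⊗ Mn ys) ⊗ Mn [ x ] ≡⟨ ⊗-assoc (Mn [ z ]) (Mn ys) (Mn [ x ]) ⟩
    Mn [ z ] ⊗ (Mn ys ⊗ Mn [ x ]) ≡⟨ cong₂ (λ P R → P ⊗ (Mn ys ⊗ R)) (⊗-identityʳ (Mk z)) (⊗-identityʳ (Mk x)) ⟩
    Mk z ⊗ (Mn ys ⊗ Mk x)         ∎

  infix 4 _≈ᴹ_[mod_]
  record _≈ᴹ_[mod_] (M P : Mat) (Q : ℕ) : Set where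
    constructor mat≈
    field
      m11≈ : Mat.m11 M ≈ Mat.m11 P [mod Q ]
      m12≈ : Mat.m12 M ≈ Mat.m12 P [mod Q ]
      m21≈ : Mat.m21 M ≈ Mat.m21 P [mod Q ]
      m22≈ : Mat.m22 M ≈ Mat.m22 P [mod Q ]
  open _≈ᴹ_[mod_] public

  ≈ᴹ-refl : ∀ {Q M} → M ≈ᴹ M [mod Q ]
  ≈ᴹ-refl = mat≈ ≈-refl ≈-refl ≈-refl ≈-refl

  ≡⇒≈ᴹ : ∀ {Q M P} → M ≡ P → M ≈ᴹ P [mod Q ]
  ≡⇒≈ᴹ refl = ≈ᴹ-refl

  ≈ᴹ-sym : ∀ {Q M P} → M ≈ᴹ P [mod Q ] → P ≈ᴹ M [mod Q ]
  ≈ᴹ-sym (mat≈ p q r s) = mat≈ (≈-sym p) (≈-sym q) (≈-sym r) (≈-sym s)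

  ≈ᴹ-trans : ∀ {Q M P R} → M ≈ᴹ P [mod Q ] → P ≈ᴹ R [mod Q ] → M ≈ᴹ R [mod Q ]
  ≈ᴹ-trans (mat≈ p q r s) (mat≈ p′ q′ r′ s′) =
    mat≈ (≈-trans p p′) (≈-trans q q′) (≈-trans r r′) (≈-trans s s′)

  ≈ᴹ-setoid : ℕ → Setoid 0ℓ 0ℓ
  ≈ᴹ-setoid Q = record
    { Carrier = Mat
    ; _≈_ = _≈ᴹ_[mod Q ]
    ; isEquivalence = record { refl = ≈ᴹ-refl ; sym = ≈ᴹ-sym ; trans = ≈ᴹ-trans }
    }

  module ≈ᴹ-Reasoning (Q : ℕ) where
    open import Relation.Binary.Reasoning.Setoid (≈ᴹ-setoid Q) public

  ⊗-cong-mod : ∀ {Q M M′ P P′} → M ≈ᴹ M′ [mod Q ] → P ≈ᴹ P′ [mod Q ] → M ⊗ P ≈ᴹ M′ ⊗ P′ [mod Q ]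
  ⊗-cong-mod (mat≈ a b c d) (mat≈ e f g h) =
    mat≈ (+-cong-mod (*-cong-mod a e) (*-cong-mod b g)) (+-cong-mod (*-cong-mod a f) (*-cong-mod b h))
         (+-cong-mod (*-cong-mod c e) (*-cong-mod d g)) (+-cong-mod (*-cong-mod c f) (*-cong-mod d h))

  Mn-cong : ∀ {Q xs ys} → xs ≋ ys [mod Q ] → Mn xs ≈ᴹ Mn ys [mod Q ]
  Mn-cong = foldl-cong ≈ᴹ-refl
    where
    foldl-cong : ∀ {Q M P xs ys} → M ≈ᴹ P [mod Q ] → xs ≋ ys [mod Q ] →
                 foldl (λ M a → Mk a ⊗ M) M xs ≈ᴹ foldl (λ M a → Mk a ⊗ M) P ys [mod Q ]
    foldl-cong M≈P [] = M≈P
    foldl-cong {M = M} {P} M≈P (_∷_ {x} {y} x≈y xs≈ys) =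
      foldl-cong (⊗-cong-mod {M = Mk x} {Mk y} {M} {P} (mat≈ (mod x≈y) ≈-refl ≈-refl ≈-refl) M≈P) xs≈ys

  unit : Sign → ℤ
  unit Sign.+ = 1ℤ
  unit Sign.- = - 1ℤ

  scalar : ℤ → Mat
  scalar x = mat x 0ℤ 0ℤ x

  Solution⇒scalar : ∀ {Q} xs → Solution Q xs → Σ Sign λ s → Mn xs ≈ᴹ scalar (unit s) [mod Q ]
  Solution⇒scalar _ (inj₁ (p , q , r , s)) = Sign.+ , mat≈ (mod p) (mod q) (mod r) (mod s)
  Solution⇒scalar _ (inj₂ (p , q , r , s)) = Sign.- , mat≈ (mod p) (mod q) (mod r) (mod s)

  scalar⇒Solution : ∀ {Q} xs s → Mn xs ≈ᴹ scalar (unit s) [mod Q ] → Solution Q xs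
  scalar⇒Solution _ Sign.+ (mat≈ p q r s) = inj₁ (unmod p , unmod q , unmod r , unmod s)
  scalar⇒Solution _ Sign.- (mat≈ p q r s) = inj₂ (unmod p , unmod q , unmod r , unmod s)

  Solution-∣ : ∀ {d Q} xs → d ℕ.∣ Q → Solution Q xs → Solution d xs
  Solution-∣ _ d∣Q (inj₁ (p , q , r , s)) =
    inj₁ (∣-trans d∣Q p , ∣-trans d∣Q q , ∣-trans d∣Q r , ∣-trans d∣Q s)
  Solution-∣ _ d∣Q (inj₂ (p , q , r , s)) =
    inj₂ (∣-trans d∣Q p , ∣-trans d∣Q q , ∣-trans d∣Q r , ∣-trans d∣Q s)

  Solution? : ∀ Q xs → Dec (Solution Q xs)
  Solution? Q xs = MatEqMod? (Mn xs) Id ⊎-dec MatEqMod? (Mn xs) (scalar (- 1ℤ))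
    where
    ≡-mod? : ∀ x y → Dec (x ≡ y [mod Q ])
    ≡-mod? x y = Q ∣? ∣ x - y ∣
    MatEqMod? : ∀ M P → Dec (MatEqMod Q M P)
    MatEqMod? (mat a b c d) (mat e f g h) = ≡-mod? a e ×-dec ≡-mod? b f ×-dec ≡-mod? c g ×-dec ≡-mod? d h

module Chebyshev where

  open Congruence
  open Matrices
  open import Data.Nat as ℕ using (ℕ; zero; suc)
  open import Data.Integer using (ℤ; _+_; _-_; _*_; -_; 0ℤ; 1ℤ)
  open import Data.Integer.Properties using (neg-involutive; *-zeroʳ)
  open import Data.Integer.Tactic.RingSolver using (solve-∀)
  open import Data.List using ([_]; _++_; replicate)
  open import Data.Product using (Σ; _×_; _,_; proj₁)
  open import Data.Sign as Sign using (Sign)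
  open import Relation.Binary.PropositionalEquality hiding ([_])

  -- u k (2 + n) = Uₙ(k/2), with Uₙ the Chebyshev polynomials of the second kind.
  u : ℤ → ℕ → ℤ
  u k 0 = - 1ℤ
  u k 1 = 0ℤ
  u k (suc (suc n)) = k * u k (suc n) - u k n

  Mn-replicate : ∀ k L → Mn (replicate L k) ≡ mat (u k (2 ℕ.+ L)) (- u k (1 ℕ.+ L)) (u k (1 ℕ.+ L)) (- u k L)
  Mn-replicate k zero = mat-cong (one k) refl refl refl
    where
    one : ∀ k → 1ℤ ≡ k * 0ℤ - - 1ℤ
    one = solve-∀
  Mn-replicate k (suc L) = begin
    Mn ([ k ] ++ replicate L k)
      ≡⟨ Mn-++ [ k ] (replicate L k) ⟩
    Mn (replicate L k) ⊗ Mn [ k ]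
      ≡⟨ cong₂ _⊗_ (Mn-replicate k L) (⊗-identityʳ (Mk k)) ⟩
    mat (u k (2 ℕ.+ L)) (- u k (1 ℕ.+ L)) (u k (1 ℕ.+ L)) (- u k L) ⊗ Mk k
      ≡⟨ ⊗-Mk _ _ _ _ k ⟩
    mat (u k (2 ℕ.+ L) * k + - u k (1 ℕ.+ L)) (- u k (2 ℕ.+ L)) (u k (1 ℕ.+ L) * k + - u k L) (- u k (1 ℕ.+ L))
      ≡⟨ mat-cong (recurrence k _ _) refl (recurrence k _ _) refl ⟩
    mat (u k (3 ℕ.+ L)) (- u k (2 ℕ.+ L)) (u k (2 ℕ.+ L)) (- u k (1 ℕ.+ L))
      ∎
    where
    open ≡-Reasoning
    recurrence : ∀ k a b → a * k + - b ≡ k * a - b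
    recurrence = solve-∀

  u-cassini : ∀ k n → u k (1 ℕ.+ n) * u k (1 ℕ.+ n) - u k n * u k (2 ℕ.+ n) ≡ 1ℤ
  u-cassini k zero = base k
    where
    base : ∀ k → 0ℤ * 0ℤ - - 1ℤ * (k * 0ℤ - - 1ℤ) ≡ 1ℤ
    base = solve-∀
  u-cassini k (suc n) = trans (shift k (u k n) (u k (1 ℕ.+ n))) (u-cassini k n)
    where
    shift : ∀ k a b → (k * b - a) * (k * b - a) - b * (k * (k * b - a) - b) ≡ b * b - a * (k * b - a)
    shift = solve-∀

  u-cassini′ : ∀ k n → u k (2 ℕ.+ n) * - u k n ≡ 1ℤ - u k (1 ℕ.+ n) * u k (1 ℕ.+ n)
  u-cassini′ k n = trans (rearrange (u k n) (u k (1 ℕ.+ n)) (u k (2 ℕ.+ n)))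
                         (cong (_- u k (1 ℕ.+ n) * u k (1 ℕ.+ n)) (u-cassini k n))
    where
    rearrange : ∀ a b c → c * - a ≡ (b * b - a * c) - b * b
    rearrange = solve-∀

  u-neighbour-sum : ∀ k n → u k (1 ℕ.+ n) + u k (3 ℕ.+ n) ≡ k * u k (2 ℕ.+ n)
  u-neighbour-sum k n = telescope (u k (1 ℕ.+ n)) (k * u k (2 ℕ.+ n))
    where
    telescope : ∀ c x → c + (x - c) ≡ x
    telescope = solve-∀

  u-neighbour-product : ∀ k n → u k (1 ℕ.+ n) * u k (3 ℕ.+ n) ≡ u k (2 ℕ.+ n) * u k (2 ℕ.+ n) - 1ℤ
  u-neighbour-product k n =
    trans (rearrange (u k (1 ℕ.+ n) * u k (3 ℕ.+ n)) (u k (2 ℕ.+ n) * u k (2 ℕ.+ n)))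
          (cong (_-_ (u k (2 ℕ.+ n) * u k (2 ℕ.+ n))) (u-cassini k (1 ℕ.+ n)))
    where
    rearrange : ∀ x y → x ≡ y - (y - x)
    rearrange = solve-∀

  unit-involutive : ∀ s x → unit s * (unit s * x) ≡ x
  unit-involutive Sign.+ = solve-∀
  unit-involutive Sign.- = solve-∀

  unit-* : ∀ s t → unit s * unit t ≡ unit (s Sign.* t)
  unit-* Sign.+ Sign.+ = refl
  unit-* Sign.+ Sign.- = refl
  unit-* Sign.- Sign.+ = refl
  unit-* Sign.- Sign.- = refl

  unit-opposite : ∀ s → - unit s ≡ unit (Sign.opposite s)
  unit-opposite Sign.+ = refl
  unit-opposite Sign.- = refl

  unit-*-self : ∀ s → unit s * unit s ≡ 1ℤ
  unit-*-self Sign.+ = refl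
  unit-*-self Sign.- = refl

  unit-square : ∀ s x → (unit s * x) * (unit s * x) ≡ x * x
  unit-square Sign.+ = solve-∀
  unit-square Sign.- = solve-∀

  infix 4 _≈±1[mod_]
  _≈±1[mod_] : ℤ → ℕ → Set
  x ≈±1[mod Q ] = Σ Sign λ s → x ≈ unit s [mod Q ]

  ≈±1-neg : ∀ {Q} x → - x ≈±1[mod Q ] → x ≈±1[mod Q ]
  ≈±1-neg {Q} x (s , h) = Sign.opposite s , (begin
    x                         ≡⟨ neg-involutive x ⟨
    - (- x)                   ≈⟨ -‿cong-mod h ⟩
    - unit s                  ≡⟨ unit-opposite s ⟩
    unit (Sign.opposite s)    ∎)
    where open ≈-Reasoning Q

  u-neighbours : ∀ {Q} k j → u k (1 ℕ.+ j) ≈ 0ℤ [mod Q ] → - u k j ≈ u k (2 ℕ.+ j) [mod Q ]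
  u-neighbours {Q} k j h = begin
    - u k j                         ≡⟨ absorb k (u k j) ⟩
    k * 0ℤ - u k j                  ≈⟨ +-congʳ-mod (- u k j) (*-congˡ-mod k (≈-sym h)) ⟩
    k * u k (1 ℕ.+ j) - u k j       ∎
    where
    open ≈-Reasoning Q
    absorb : ∀ k x → - x ≡ k * 0ℤ - x
    absorb = solve-∀

  Solution-replicate⇒ : ∀ {Q} k L → Solution Q (replicate L k) →
                        u k (1 ℕ.+ L) ≈ 0ℤ [mod Q ] × u k (2 ℕ.+ L) ≈±1[mod Q ]
  Solution-replicate⇒ k L sol with Solution⇒scalar (replicate L k) sol
  ... | s , h with subst (λ M → M ≈ᴹ scalar (unit s) [mod _ ]) (Mn-replicate k L) h
  ... | mat≈ p _ r _ = r , s , p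

  Solution-replicate⇐ : ∀ {Q} k L → u k (1 ℕ.+ L) ≈ 0ℤ [mod Q ] → u k (2 ℕ.+ L) ≈±1[mod Q ] →
                        Solution Q (replicate L k)
  Solution-replicate⇐ k L r (s , p) = scalar⇒Solution (replicate L k) s
    (subst (λ M → M ≈ᴹ scalar (unit s) [mod _ ]) (sym (Mn-replicate k L))
      (mat≈ p (-‿cong-mod r) r (≈-trans (u-neighbours k L r) p)))

  u-corner : ∀ {Q} k L s → u k (2 ℕ.+ L) ≈ unit s [mod Q ] →
             - u k L ≈ unit s * (1ℤ - u k (1 ℕ.+ L) * u k (1 ℕ.+ L)) [mod Q ]
  u-corner {Q} k L s α≈σ = begin
    - u k L                                   ≡⟨ unit-involutive s (- u k L) ⟨
    σ * (σ * - u k L)                         ≈⟨ *-congˡ-mod σ (*-congʳ-mod (- u k L) (≈-sym α≈σ)) ⟩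
    σ * (u k (2 ℕ.+ L) * - u k L)             ≡⟨ cong (σ *_) (u-cassini′ k L) ⟩
    σ * (1ℤ - u k (1 ℕ.+ L) * u k (1 ℕ.+ L))  ∎
    where
    open ≈-Reasoning Q
    σ = unit s

  u-quasi-periodic : ∀ {Q} k n → Solution Q (replicate n k) →
                     Σ Sign λ s → ∀ i → u k (i ℕ.+ n) ≈ unit s * u k i [mod Q ]
  u-quasi-periodic {Q} k n sol with Solution-replicate⇒ k n sol
  ... | r , s , p = s , λ i → proj₁ (pair i)
    where
    open ≈-Reasoning Q
    σ = unit s
    negate : ∀ x → - x ≡ x * - 1ℤ
    negate = solve-∀
    pull-out : ∀ k σ a b → k * (σ * a) - σ * b ≡ σ * (k * a - b)
    pull-out = solve-∀
    pair : ∀ i → u k (i ℕ.+ n) ≈ σ * u k i [mod Q ] × u k (suc i ℕ.+ n) ≈ σ * u k (suc i) [mod Q ]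
    pair zero = at-zero , (begin
      u k (1 ℕ.+ n) ≈⟨ r ⟩
      0ℤ            ≡⟨ *-zeroʳ σ ⟨
      σ * 0ℤ        ∎)
      where
      at-zero : u k n ≈ σ * - 1ℤ [mod Q ]
      at-zero = begin
        u k n         ≡⟨ neg-involutive (u k n) ⟨
        - (- u k n)   ≈⟨ -‿cong-mod (≈-trans (u-neighbours k n r) p) ⟩
        - σ           ≡⟨ negate σ ⟩
        σ * - 1ℤ      ∎
    pair (suc i) with pair i
    ... | h₀ , h₁ = h₁ , (begin
      k * u k (suc i ℕ.+ n) - u k (i ℕ.+ n) ≈⟨ +-cong-mod (*-congˡ-mod k h₁) (-‿cong-mod h₀) ⟩
      k * (σ * u k (suc i)) - σ * u k i     ≡⟨ pull-out k σ (u k (suc i)) (u k i) ⟩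
      σ * (k * u k (suc i) - u k i)         ∎)

module Reduction where

  open Congruence
  open Matrices
  open Chebyshev
  open import Data.Nat as ℕ using (ℕ; zero; suc; _≤_; _<_; s≤s; z≤n)
  open import Data.Nat.Properties as ℕ using (+-cancelʳ-≤; m≤n⇒∃[o]m+o≡n; m≤n+m)
  open import Data.Nat.Tactic.RingSolver as ℕ using ()
  open import Data.Integer using (ℤ; _+_; _-_; _*_; -_; 1ℤ)
  open import Data.Integer.Tactic.RingSolver using (solve-∀)
  open import Data.List using (List; []; _∷_; _++_; [_]; length; replicate; take; drop; reverse; initLast; _∷ʳ′_)
  open import Data.List.Properties using (length-++; length-replicate; take++drop≡id; ++-identityʳ)
  open import Data.List.Relation.Unary.All as All using (All; []; _∷_)
  open import Data.List.Relation.Unary.All.Properties using (++⁻ʳ; ++⁺; replicate⁺)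
  open import Data.List.Relation.Binary.Pointwise using ([]; _∷_; Pointwise-length)
  open import Data.List.Relation.Binary.Permutation.Propositional using (_↭_; ↭-trans; ↭-reflexive)
  open import Data.List.Relation.Binary.Permutation.Propositional.Properties
    using (++-comm; ↭-reverse; ↭-length; All-resp-↭)
  open import Data.Product using (Σ; _×_; _,_)
  import Data.Sign as Sign
  open import Data.Sum using (inj₁; inj₂)
  open import Relation.Binary.PropositionalEquality hiding ([_])

  rotate-↭ : ∀ j (xs : List ℤ) → rotate j xs ↭ xs
  rotate-↭ j xs = ↭-trans (++-comm (drop j xs) (take j xs)) (↭-reflexive (take++drop≡id j xs))

  Equiv⇒≋-↭ : ∀ {Q xs ys} → Equiv Q xs ys → Σ (List ℤ) λ zs → xs ≋ zs [mod Q ] × zs ↭ ys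
  Equiv⇒≋-↭ {ys = ys} (j , _ , inj₁ h) = rotate j ys , h , rotate-↭ j ys
  Equiv⇒≋-↭ {ys = ys} (j , _ , inj₂ h) =
    rotate j (reverse ys) , h , ↭-trans (rotate-↭ j (reverse ys)) (↭-reverse ys)

  ≋-replicate⇒All : ∀ {Q k} n {ys} → replicate n k ≋ ys [mod Q ] → All (λ y → k ≡ y [mod Q ]) ys
  ≋-replicate⇒All zero [] = []
  ≋-replicate⇒All (suc n) (h ∷ hs) = h ∷ ≋-replicate⇒All n hs

  All⇒≋-replicate : ∀ {Q k ys} → All (λ y → k ≡ y [mod Q ]) ys → replicate (length ys) k ≋ ys [mod Q ]
  All⇒≋-replicate [] = []
  All⇒≋-replicate (h ∷ hs) = h ∷ All⇒≋-replicate hs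

  Equiv-replicate⇒ : ∀ {Q k} n ys → Equiv Q (replicate n k) ys →
                     All (λ y → k ≡ y [mod Q ]) ys × length ys ≡ n
  Equiv-replicate⇒ n ys eqv with Equiv⇒≋-↭ eqv
  ... | zs , h , zs↭ys =
    All-resp-↭ zs↭ys (≋-replicate⇒All n h) ,
    trans (sym (↭-length zs↭ys)) (trans (sym (Pointwise-length h)) (length-replicate n))

  Equiv-replicate⇐ : ∀ {Q k} ys → All (λ y → k ≡ y [mod Q ]) ys → 0 < length ys →
                     Equiv Q (replicate (length ys) k) ys
  Equiv-replicate⇐ {Q} {k} ys all 0<len = 0 , 0<len , inj₁
    (subst (λ zs → replicate (length ys) k ≋ zs [mod Q ]) (sym (++-identityʳ ys)) (All⇒≋-replicate all))

  split-ends : ∀ (xs : List ℤ) → 3 ≤ length xs →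
               Σ ℤ λ x → Σ (List ℤ) λ ys → Σ ℤ λ z → xs ≡ x ∷ ys ++ [ z ] × 1 ≤ length ys
  split-ends (x ∷ rest) (s≤s 2≤rest) with initLast rest
  split-ends (x ∷ .[]) (s≤s ()) | []
  ... | ys ∷ʳ′ z = x , ys , z , refl , +-cancelʳ-≤ 1 1 (length ys) (subst (2 ≤_) (length-++ ys) 2≤rest)

  length-ends : ∀ (x : ℤ) ys z → length (x ∷ ys ++ [ z ]) ≡ 2 ℕ.+ length ys
  length-ends x ys z = cong suc (trans (length-++ ys) (ℕ.+-comm (length ys) 1))

  lst-ends : ∀ (x : ℤ) ys z → lst (x ∷ ys ++ [ z ]) ≡ z
  lst-ends x [] z = refl
  lst-ends x (y ∷ ys) z = lst-ends y ys z

  inner-ends : ∀ (x : ℤ) ys z → inner (x ∷ ys ++ [ z ]) ≡ ys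
  inner-ends x ys z = cong (drop 1) (take-ends x ys z)
    where
    take-ends : ∀ (x : ℤ) ys z → take (length (ys ++ [ z ])) (x ∷ ys ++ [ z ]) ≡ x ∷ ys
    take-ends x [] z = refl
    take-ends x (y ∷ ys) z = cong (x ∷_) (take-ends y ys z)

  ⊕-ends : ∀ x xs y z zs w → (x ∷ xs ++ [ y ]) ⊕ (z ∷ zs ++ [ w ]) ≡ x + w ∷ xs ++ y + z ∷ zs
  ⊕-ends x xs y z zs w
    rewrite lst-ends z zs w | lst-ends x xs y | inner-ends x xs y | inner-ends z zs w = refl

  -- By Cassini, M_L(k, …, k) ≡ σ [[1, -y], [y, 1 - y²]] modulo Q, where y = σ u (1+L).
  ends-solution : ∀ {Q} k L s → u k (2 ℕ.+ L) ≈ unit s [mod Q ] →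
                  let y = unit s * u k (1 ℕ.+ L) in Solution Q (y ∷ replicate L k ++ [ y ])
  ends-solution {Q} k L s α≈σ = scalar⇒Solution (y ∷ replicate L k ++ [ y ]) (Sign.opposite s) (begin
    Mn (y ∷ replicate L k ++ [ y ])
      ≡⟨ Mn-ends y (replicate L k) y ⟩
    Mk y ⊗ (Mn (replicate L k) ⊗ Mk y)
      ≡⟨ cong (λ P → Mk y ⊗ (P ⊗ Mk y)) (Mn-replicate k L) ⟩
    Mk y ⊗ (mat α (- c) c (- u k L) ⊗ Mk y)
      ≈⟨ ⊗-cong-mod {M = Mk y} ≈ᴹ-refl (⊗-cong-mod {P = Mk y} P≈S ≈ᴹ-refl) ⟩
    Mk y ⊗ (mat σ (- (σ * y)) (σ * y) (σ * (1ℤ - y * y)) ⊗ Mk y)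
      ≡⟨ Mk-sandwich-scaled σ y ⟩
    scalar (- σ)
      ≡⟨ cong scalar (unit-opposite s) ⟩
    scalar (unit (Sign.opposite s))
      ∎)
    where
    open ≈ᴹ-Reasoning Q
    σ = unit s
    c = u k (1 ℕ.+ L)
    α = u k (2 ℕ.+ L)
    y = σ * c
    P≈S : mat α (- c) c (- u k L) ≈ᴹ mat σ (- (σ * y)) (σ * y) (σ * (1ℤ - y * y)) [mod Q ]
    P≈S = mat≈ α≈σ (≡⇒≈ (cong -_ (sym (unit-involutive s c)))) (≡⇒≈ (sym (unit-involutive s c)))
      (≈-trans (u-corner k L s α≈σ) (≡⇒≈ (cong (λ t → σ * (1ℤ - t)) (sym (unit-square s c)))))

  reducible-replicate⇒ : ∀ {Q} k n → Reducible Q (replicate n k) →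
                         Σ ℕ λ L → 1 ≤ L × 3 ℕ.+ L ≤ n × u k (2 ℕ.+ L) ≈±1[mod Q ]
  reducible-replicate⇒ {Q} k n (bs , as , sol , 3≤bs , 3≤as , eqv)
    with split-ends bs 3≤bs | split-ends as 3≤as
  ... | x , ys , z , refl , 1≤L | x′ , ys′ , z′ , refl , 1≤ys′
    with Equiv-replicate⇒ n _ (subst (Equiv Q (replicate n k)) (⊕-ends x′ ys′ z′ x ys z) eqv)
       | Solution⇒scalar (x ∷ ys ++ [ z ]) sol
  ... | all , len | s , bs≈σ = L , 1≤L , bound , ≈±1-neg (u k (2 ℕ.+ L)) (s , (begin
    - u k (2 ℕ.+ L)                               ≡⟨ cong (λ M → - Mat.m11 M) (Mn-replicate k L) ⟨
    - Mat.m11 (Mn (replicate L k))                ≡⟨ m22-Mk-sandwich z (Mn (replicate L k)) x ⟨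
    Mat.m22 (Mk z ⊗ (Mn (replicate L k) ⊗ Mk x))  ≈⟨ m22≈ sandwich≈ ⟩
    Mat.m22 (Mn (x ∷ ys ++ [ z ]))                ≈⟨ m22≈ bs≈σ ⟩
    unit s                                        ∎))
    where
    open ≈-Reasoning Q
    L = length ys
    ys≈k : replicate L k ≋ ys [mod Q ]
    ys≈k = All⇒≋-replicate (All.tail (++⁻ʳ ys′ (All.tail all)))
    sandwich≈ : Mk z ⊗ (Mn (replicate L k) ⊗ Mk x) ≈ᴹ Mn (x ∷ ys ++ [ z ]) [mod Q ]
    sandwich≈ = ≈ᴹ-trans (⊗-cong-mod {M = Mk z} ≈ᴹ-refl (⊗-cong-mod {P = Mk x} (Mn-cong ys≈k) ≈ᴹ-refl))
                         (≡⇒≈ᴹ (sym (Mn-ends x ys z)))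
    bound : 3 ℕ.+ L ≤ n
    bound = subst (3 ℕ.+ L ≤_) (trans (cong suc (sym (length-++ ys′))) len) (ends-bound (length ys′) 1≤ys′)
      where
      ends-bound : ∀ m → 1 ≤ m → 3 ℕ.+ L ≤ suc (m ℕ.+ suc L)
      ends-bound (suc m) _ = s≤s (s≤s (m≤n+m (suc L) m))

  reducible-replicate⇐ : ∀ {Q} k n L → 1 ≤ L → 3 ℕ.+ L ≤ n → u k (2 ℕ.+ L) ≈±1[mod Q ] →
                         Reducible Q (replicate n k)
  reducible-replicate⇐ {Q} k n L 1≤L 3+L≤n (s , α≈σ) with m≤n⇒∃[o]m+o≡n 3+L≤n
  ... | t , refl =
    bs , as , ends-solution k L s α≈σ , length≥3 y L 1≤L , length≥3 (k - y) (suc t) (s≤s z≤n) ,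
    subst (λ m → Equiv Q (replicate m k) (as ⊕ bs)) length-zs
      (subst (Equiv Q (replicate (length zs) k)) (sym as⊕bs≡zs)
        (Equiv-replicate⇐ zs (k≡w ∷ ++⁺ (replicate⁺ (suc t) k≡k) (k≡w ∷ replicate⁺ L k≡k)) (s≤s z≤n)))
    where
    y = unit s * u k (1 ℕ.+ L)
    w = (k - y) + y
    bs = y ∷ replicate L k ++ [ y ]
    as = (k - y) ∷ replicate (suc t) k ++ [ k - y ]
    zs = w ∷ replicate (suc t) k ++ w ∷ replicate L k
    as⊕bs≡zs : as ⊕ bs ≡ zs
    as⊕bs≡zs = ⊕-ends (k - y) (replicate (suc t) k) (k - y) y (replicate L k) y
    k≡k : k ≡ k [mod Q ]
    k≡k = unmod (≈-refl {x = k})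
    k≡w : k ≡ w [mod Q ]
    k≡w = unmod (≡⇒≈ (cancel k y))
      where
      cancel : ∀ k y → k ≡ (k - y) + y
      cancel = solve-∀
    length≥3 : ∀ x m → 1 ≤ m → 3 ≤ length (x ∷ replicate m k ++ [ x ])
    length≥3 x m 1≤m = subst (3 ≤_)
      (sym (trans (length-ends x (replicate m k) x) (cong (2 ℕ.+_) (length-replicate m))))
      (s≤s (s≤s 1≤m))
    length-zs : length zs ≡ 3 ℕ.+ L ℕ.+ t
    length-zs = begin
      suc (length (replicate (suc t) k ++ w ∷ replicate L k))
        ≡⟨ cong suc (length-++ (replicate (suc t) k)) ⟩
      suc (length (replicate (suc t) k) ℕ.+ suc (length (replicate L k)))
        ≡⟨ cong₂ (λ a b → suc (a ℕ.+ suc b)) (length-replicate (suc t)) (length-replicate L) ⟩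
      suc (suc t ℕ.+ suc L)
        ≡⟨ reorder t L ⟩
      3 ℕ.+ L ℕ.+ t
        ∎
      where
      open ≡-Reasoning
      reorder : ∀ t L → suc (suc t ℕ.+ suc L) ≡ 3 ℕ.+ L ℕ.+ t
      reorder = ℕ.solve-∀

module MinimalSolutions where

  open Congruence
  open Matrices
  open Chebyshev
  open Reduction
  open import Data.Nat as ℕ using (ℕ; zero; suc; _≤_; _<_; _∸_; s≤s; z≤n)
  open import Data.Nat.Properties as ℕ
    using (_<?_; ≤-refl; ≮⇒≥; ∸-monoʳ-<; m∸n+n≡m; m≤n⇒∃[o]m+o≡n; +-comm; m≤n+m; m≤n⇒m<n∨m≡n)
  open import Data.Nat.Divisibility as ℕ using (∣1⇒≡1)
  open import Data.Nat.Induction using (<-rec)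
  open import Data.Integer using (ℤ; _*_; 0ℤ)
  open import Data.Integer.Properties using (*-zeroʳ)
  open import Data.Empty using (⊥-elim)
  open import Data.List using (replicate)
  open import Data.Product using (Σ; _×_; _,_)
  import Data.Sign as Sign
  open import Data.Sum using (_⊎_; inj₁; inj₂; [_,_]′)
  open import Function using (id; _∘′_)
  open import Relation.Nullary using (¬_; Dec; yes; no)
  open import Relation.Binary.PropositionalEquality hiding ([_])

  least-positive : ∀ {P : ℕ → Set} → (∀ n → Dec (P n)) → ∀ n → 1 ≤ n → P n →
                   Σ ℕ λ m → 1 ≤ m × P m × (∀ j → 1 ≤ j → j < m → ¬ P j)
  least-positive {P} P? n 1≤n Pn = [ (λ none → ⊥-elim (none n 1≤n ≤-refl Pn)) , id ]′ (scan n)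
    where
    scan : ∀ n → (∀ j → 1 ≤ j → j ≤ n → ¬ P j) ⊎ Σ ℕ λ m → 1 ≤ m × P m × (∀ j → 1 ≤ j → j < m → ¬ P j)
    scan zero = inj₁ λ { (suc j) _ () }
    scan (suc n) with scan n | P? (suc n)
    ... | inj₂ least | _      = inj₂ least
    ... | inj₁ none  | yes Pm = inj₂ (suc n , s≤s z≤n , Pm , λ j 1≤j j<m → none j 1≤j (ℕ.s≤s⁻¹ j<m))
    ... | inj₁ none  | no ¬Pm = inj₁ λ j 1≤j j≤m →
      [ (λ j<m → none j 1≤j (ℕ.s≤s⁻¹ j<m)) , (λ { refl → ¬Pm }) ]′ (m≤n⇒m<n∨m≡n j≤m)

  periodic-induction : ∀ {P : ℕ → Set} n → 1 ≤ n →
                       (∀ j → j < n → P j) → (∀ j → P j → P (j ℕ.+ n)) → ∀ j → P j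
  periodic-induction {P} n 1≤n below shift = <-rec P go
    where
    go : ∀ j → (∀ {i} → i < j → P i) → P j
    go j rec with j <? n
    ... | yes j<n = below j j<n
    ... | no j≮n  = subst P (m∸n+n≡m n≤j) (shift (j ∸ n) (rec (∸-monoʳ-< 1≤n n≤j)))
      where n≤j = ≮⇒≥ j≮n

  monomial-minimal-length : ∀ {Q} k n → 1 ≤ n → Solution Q (replicate n k) →
                            Σ ℕ (IsMonomialMinimalLength Q k)
  monomial-minimal-length {Q} k = least-positive (λ j → Solution? Q (replicate j k))

  unit≉0 : ∀ {Q} s → Q ≢ 1 → ¬ (unit s ≈ 0ℤ [mod Q ])
  unit≉0 Sign.+ Q≢1 (mod Q∣1) = Q≢1 (∣1⇒≡1 Q∣1)
  unit≉0 Sign.- Q≢1 (mod Q∣1) = Q≢1 (∣1⇒≡1 Q∣1)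

  ZeroNeighbour : ℕ → ℤ → ℕ → Set
  ZeroNeighbour Q k j =
    u k (2 ℕ.+ j) ≈±1[mod Q ] → u k (1 ℕ.+ j) ≈ 0ℤ [mod Q ] ⊎ u k (3 ℕ.+ j) ≈ 0ℤ [mod Q ]

  -- Below the minimal length n: j = n - 1 contradicts u (1+n) ≡ 0, j = n - 2 is the second
  -- alternative, and any smaller j ≥ 1 makes the minimal solution reducible.
  irreducible⇒zero-neighbour : ∀ {Q} k n → Q ≢ 1 → IsMonomialMinimalLength Q k n →
                               ¬ Reducible Q (replicate n k) → ∀ j → ZeroNeighbour Q k j
  irreducible⇒zero-neighbour {Q} k n Q≢1 (1≤n , sol , _) irreducible = periodic-induction n 1≤n below shift
    where
    vanishes-at : ∀ {m} → m ≡ n → u k (1 ℕ.+ m) ≈ 0ℤ [mod Q ]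
    vanishes-at refl with Solution-replicate⇒ k n sol
    ... | u≈0 , _ = u≈0

    below : ∀ j → j < n → ZeroNeighbour Q k j
    below zero _ _ = inj₁ ≈-refl
    below (suc j) j<n (s , u≈σ) with m≤n⇒∃[o]m+o≡n j<n
    ... | o , eq with o | trans (+-comm o (2 ℕ.+ j)) eq
    ... | zero        | n≡ = ⊥-elim (unit≉0 s Q≢1 (≈-trans (≈-sym u≈σ) (vanishes-at n≡)))
    ... | suc zero    | n≡ = inj₂ (vanishes-at n≡)
    ... | suc (suc r) | n≡ = ⊥-elim (irreducible (reducible-replicate⇐ k n (suc j) (s≤s z≤n)
          (subst (3 ℕ.+ suc j ≤_) n≡ (s≤s (s≤s (m≤n+m (suc (suc j)) r)))) (s , u≈σ)))

    shift : ∀ j → ZeroNeighbour Q k j → ZeroNeighbour Q k (j ℕ.+ n)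
    shift j zero-neighbour (t , u≈τ) with u-quasi-periodic k n sol
    ... | s , periodic =
      [ inj₁ ∘′ transport (1 ℕ.+ j) , inj₂ ∘′ transport (3 ℕ.+ j) ]′ (zero-neighbour (s Sign.* t , (begin
        u k (2 ℕ.+ j)                      ≡⟨ unit-involutive s _ ⟨
        unit s * (unit s * u k (2 ℕ.+ j))  ≈⟨ *-congˡ-mod (unit s) (≈-trans (≈-sym (periodic (2 ℕ.+ j))) u≈τ) ⟩
        unit s * unit t                    ≡⟨ unit-* s t ⟩
        unit (s Sign.* t)                  ∎)))
      where
      open ≈-Reasoning Q
      transport : ∀ i → u k i ≈ 0ℤ [mod Q ] → u k (i ℕ.+ n) ≈ 0ℤ [mod Q ]
      transport i u≈0 = ≈-trans (periodic i) (≈-trans (*-congˡ-mod (unit s) u≈0) (≡⇒≈ (*-zeroʳ (unit s))))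

module PrimePowers where

  open Congruence
  open import Data.Nat as ℕ using (zero; suc; _*_; _^_)
  open import Data.Nat.Divisibility using (_∣_; divides; 1∣_; ∣-trans; m∣m*n; n∣m*n; *-monoʳ-∣; *-cancelˡ-∣)
  open import Data.Nat.Primality using (Prime; euclidsLemma; prime⇒nonZero)
  open import Data.Nat.Properties using (*-comm; *-assoc)
  open import Data.Integer as ℤ using (_+_; 0ℤ; ∣_∣)
  open import Data.Integer.Properties as ℤ using (abs-*; +-identityʳ)
  open import Data.Sum using (_⊎_; inj₁; inj₂)
  open import Relation.Nullary using (¬_; contradiction)
  open import Relation.Binary.PropositionalEquality using (_≡_; refl; subst; sym; trans; cong)

  p^l∣m*n⇒p^l∣m : ∀ {p n} → Prime p → ¬ p ∣ n → ∀ l m → p ^ l ∣ m * n → p ^ l ∣ m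
  p^l∣m*n⇒p^l∣m p-prime p∤n zero m _ = 1∣ m
  p^l∣m*n⇒p^l∣m {p} {n} p-prime p∤n (suc l) m p^l∣m*n
    with euclidsLemma m n p-prime (∣-trans (m∣m*n (p ^ l)) p^l∣m*n)
  ... | inj₂ p∣n = contradiction p∣n p∤n
  ... | inj₁ (divides q refl) =
    subst (p * p ^ l ∣_) (*-comm p q) (*-monoʳ-∣ p (p^l∣m*n⇒p^l∣m p-prime p∤n l q
      (*-cancelˡ-∣ p {{prime⇒nonZero p-prime}} (subst (p * p ^ l ∣_) (regroup q) p^l∣m*n))))
    where
    regroup : ∀ q → q * p * n ≡ p * (q * n)
    regroup q = trans (cong (_* n) (*-comm q p)) (*-assoc p q n)

  ∣∧p^l∣⇒*p^l∣ : ∀ {p A m} → Prime p → ¬ p ∣ A → ∀ l → A ∣ m → p ^ l ∣ m → A * p ^ l ∣ m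
  ∣∧p^l∣⇒*p^l∣ {p} {A} p-prime p∤A l (divides q refl) p^l∣qA =
    subst (A * p ^ l ∣_) (*-comm A q) (*-monoʳ-∣ A (p^l∣m*n⇒p^l∣m p-prime p∤A l q p^l∣qA))

  ≈0⇒∣ : ∀ {Q} x → x ≈ 0ℤ [mod Q ] → Q ∣ ∣ x ∣
  ≈0⇒∣ {Q} x (mod h) = subst (λ z → Q ∣ ∣ z ∣) (+-identityʳ x) h

  ∣⇒≈0 : ∀ {Q} x → Q ∣ ∣ x ∣ → x ≈ 0ℤ [mod Q ]
  ∣⇒≈0 {Q} x h = mod (subst (λ z → Q ∣ ∣ z ∣) (sym (+-identityʳ x)) h)

  -- d excludes x vanishing modulo one of A, B and y modulo the other; p divides at most one of
  -- x and y, so pˡ divides that one.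
  vanishing-lifts : ∀ {A B d p} l x y → Prime p → ¬ p ∣ A → p ∣ B → d ∣ A → d ∣ B →
    ¬ (x + y ≈ 0ℤ [mod d ]) → ¬ (x + y ≈ 0ℤ [mod p ]) → x ℤ.* y ≈ 0ℤ [mod A * p ^ l ] →
    x ≈ 0ℤ [mod A ] ⊎ y ≈ 0ℤ [mod A ] → x ≈ 0ℤ [mod B ] ⊎ y ≈ 0ℤ [mod B ] →
    x ≈ 0ℤ [mod A * p ^ l ] ⊎ y ≈ 0ℤ [mod A * p ^ l ]
  vanishing-lifts {A} {B} {d} {p} l x y p-prime p∤A p∣B d∣A d∣B d∤x+y p∤x+y xy≈0 = cases
    where
    one-side : ∀ x y → x ≈ 0ℤ [mod A ] → x ≈ 0ℤ [mod B ] → ¬ (x + y ≈ 0ℤ [mod p ]) →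
               x ℤ.* y ≈ 0ℤ [mod A * p ^ l ] → x ≈ 0ℤ [mod A * p ^ l ]
    one-side x y A∣x B∣x p∤x+y xy≈0 = ∣⇒≈0 x (∣∧p^l∣⇒*p^l∣ p-prime p∤A l (≈0⇒∣ x A∣x)
      (p^l∣m*n⇒p^l∣m p-prime (λ p∣y → p∤x+y (+-cong-mod (≈-∣ p∣B B∣x) (∣⇒≈0 y p∣y))) l ∣ x ∣
        (subst (p ^ l ∣_) (abs-* x y) (∣-trans (n∣m*n A) (≈0⇒∣ (x ℤ.* y) xy≈0)))))

    cases : x ≈ 0ℤ [mod A ] ⊎ y ≈ 0ℤ [mod A ] → x ≈ 0ℤ [mod B ] ⊎ y ≈ 0ℤ [mod B ] →
            x ≈ 0ℤ [mod A * p ^ l ] ⊎ y ≈ 0ℤ [mod A * p ^ l ]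
    cases (inj₁ A∣x) (inj₁ B∣x) = inj₁ (one-side x y A∣x B∣x p∤x+y xy≈0)
    cases (inj₂ A∣y) (inj₂ B∣y) = inj₂ (one-side y x A∣y B∣y
      (subst (λ z → ¬ (z ≈ 0ℤ [mod p ])) (ℤ.+-comm x y) p∤x+y)
      (subst (_≈ 0ℤ [mod A * p ^ l ]) (ℤ.*-comm x y) xy≈0))
    cases (inj₁ A∣x) (inj₂ B∣y) = contradiction (+-cong-mod (≈-∣ d∣A A∣x) (≈-∣ d∣B B∣y)) d∤x+y
    cases (inj₂ A∣y) (inj₁ B∣x) = contradiction (+-cong-mod (≈-∣ d∣B B∣x) (≈-∣ d∣A A∣y)) d∤x+y

module Lifting where

  open Congruence
  open Matrices
  open Chebyshev
  open Reduction
  open MinimalSolutions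
  open PrimePowers
  open import Data.Nat as ℕ using (suc; _≤_; s≤s; z≤n; _^_)
  open import Data.Nat.Divisibility using (_∣_; ∣-trans; m∣m*n; ∣1⇒≡1)
  open import Data.Nat.Primality using (Prime)
  open import Data.Nat.Properties using (≤-trans; m≤n+m)
  open import Data.Integer using (_+_; _-_; _*_; -_; 0ℤ; 1ℤ)
  open import Data.Integer.Properties using (*-zeroʳ; *-comm)
  open import Data.Integer.Tactic.RingSolver using (solve-∀)
  open import Data.Empty using (⊥)
  open import Data.List using (replicate)
  open import Data.List.Properties using (length-replicate)
  open import Data.Product using (_,_; proj₁; proj₂)
  import Data.Sign as Sign
  open import Data.Sum using ([_,_]′)
  open import Relation.Nullary using (¬_; contradiction)
  open import Relation.Binary.PropositionalEquality hiding ([_])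

  unit-multiple≈0 : ∀ {Q} k α s → α ≈ unit s [mod Q ] → k * α ≈ 0ℤ [mod Q ] → k ≈ 0ℤ [mod Q ]
  unit-multiple≈0 {Q} k α s α≈σ kα≈0 = begin
    k                        ≡⟨ unit-involutive s k ⟨
    unit s * (unit s * k)    ≡⟨ cong (unit s *_) (*-comm (unit s) k) ⟩
    unit s * (k * unit s)    ≈⟨ *-congˡ-mod (unit s) (*-congˡ-mod k (≈-sym α≈σ)) ⟩
    unit s * (k * α)         ≈⟨ *-congˡ-mod (unit s) kα≈0 ⟩
    unit s * 0ℤ              ≡⟨ *-zeroʳ (unit s) ⟩
    0ℤ                       ∎
    where open ≈-Reasoning Q

  monomial-solution-length≥3 : ∀ {Q d} k n → d ∣ Q → d ≢ 1 → ¬ (k ≈ 0ℤ [mod d ]) →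
                               1 ≤ n → Solution Q (replicate n k) → 3 ≤ n
  monomial-solution-length≥3 k 1 d∣Q d≢1 d∤k _ sol =
    contradiction (≈-trans (≡⇒≈ (sym (u₂ k))) (≈-∣ d∣Q (proj₁ (Solution-replicate⇒ k 1 sol))))
                  (unit≉0 Sign.+ d≢1)
    where
    u₂ : ∀ k → k * 0ℤ - - 1ℤ ≡ 1ℤ
    u₂ = solve-∀
  monomial-solution-length≥3 k 2 d∣Q d≢1 d∤k _ sol =
    contradiction (≈-trans (≡⇒≈ (sym (u₃ k))) (≈-∣ d∣Q (proj₁ (Solution-replicate⇒ k 2 sol)))) d∤k
    where
    u₃ : ∀ k → k * (k * 0ℤ - - 1ℤ) - 0ℤ ≡ k
    u₃ = solve-∀
  monomial-solution-length≥3 k (suc (suc (suc n))) _ _ _ _ _ = s≤s (s≤s (s≤s z≤n))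

  monomial-minimal-irreducible-lift :
    ∀ {A B d p} l k → Prime p → ¬ p ∣ A → p ∣ B → B ∣ A ℕ.* p ^ l → d ∣ A → d ∣ B → d ≢ 1 →
    ¬ (k ≈ 0ℤ [mod d ]) → ¬ (k ≈ 0ℤ [mod p ]) →
    MonomialMinimalIrreducible A k → MonomialMinimalIrreducible B k →
    MonomialMinimalIrreducible (A ℕ.* p ^ l) k
  monomial-minimal-irreducible-lift {A} {B} {d} {p} l k p-prime p∤A p∣B B∣N d∣A d∣B d≢1 d∤k p∤k irrA irrB
                                    n (1≤n , sol , minimal) =
    sol ,
    subst (3 ≤_) (sym (length-replicate n)) (monomial-solution-length≥3 k n d∣N d≢1 d∤k 1≤n sol) ,
    λ red → let L , 1≤L , 3+L≤n , s , α≈σ = reducible-replicate⇒ k n red in no-reduction L 1≤L 3+L≤n s α≈σ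
    where
    N = A ℕ.* p ^ l
    A∣N = m∣m*n (p ^ l)
    d∣N = ∣-trans d∣A A∣N

    zero-neighbour : ∀ {Q} → Q ∣ N → d ∣ Q → MonomialMinimalIrreducible Q k → ∀ j → ZeroNeighbour Q k j
    zero-neighbour Q∣N d∣Q irrQ with monomial-minimal-length k n 1≤n (Solution-∣ (replicate n k) Q∣N sol)
    ... | m , minQ =
      irreducible⇒zero-neighbour k m (λ { refl → d≢1 (∣1⇒≡1 d∣Q) }) minQ (proj₂ (proj₂ (irrQ m minQ)))

    no-reduction : ∀ L → 1 ≤ L → 3 ℕ.+ L ≤ n → ∀ s → u k (2 ℕ.+ L) ≈ unit s [mod N ] → ⊥
    no-reduction L 1≤L 3+L≤n s α≈σ =
      [ vanishes-at-L , vanishes-at-2+L ]′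
        (vanishing-lifts l c g p-prime p∤A p∣B d∣A d∣B (sum-not-divisible d∣N d∤k) (sum-not-divisible p∣N p∤k) cg≈0
          (zero-neighbour A∣N d∣A irrA L (s , ≈-∣ A∣N α≈σ)) (zero-neighbour B∣N d∣B irrB L (s , ≈-∣ B∣N α≈σ)))
      where
      c = u k (1 ℕ.+ L)
      α = u k (2 ℕ.+ L)
      g = u k (3 ℕ.+ L)
      p∣N = ∣-trans p∣B B∣N

      vanishes-at-L : c ≈ 0ℤ [mod N ] → ⊥
      vanishes-at-L c≈0 =
        minimal L 1≤L (≤-trans (m≤n+m (suc L) 2) 3+L≤n) (Solution-replicate⇐ k L c≈0 (s , α≈σ))

      vanishes-at-2+L : g ≈ 0ℤ [mod N ] → ⊥
      vanishes-at-2+L g≈0 = minimal (2 ℕ.+ L) (s≤s z≤n) 3+L≤n (Solution-replicate⇐ k (2 ℕ.+ L) g≈0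
        (Sign.opposite s , ≈-trans (≈-sym (u-neighbours k (2 ℕ.+ L) g≈0))
                                   (≈-trans (-‿cong-mod α≈σ) (≡⇒≈ (unit-opposite s)))))

      sum-not-divisible : ∀ {q} → q ∣ N → ¬ (k ≈ 0ℤ [mod q ]) → ¬ (c + g ≈ 0ℤ [mod q ])
      sum-not-divisible q∣N q∤k c+g≈0 =
        q∤k (unit-multiple≈0 k α s (≈-∣ q∣N α≈σ) (subst (_≈ 0ℤ [mod _ ]) (u-neighbour-sum k L) c+g≈0))

      cg≈0 : c * g ≈ 0ℤ [mod N ]
      cg≈0 = begin
        c * g                  ≡⟨ u-neighbour-product k L ⟩
        α * α - 1ℤ             ≈⟨ +-congʳ-mod (- 1ℤ) (*-cong-mod α≈σ α≈σ) ⟩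
        unit s * unit s - 1ℤ   ≡⟨ cong (_- 1ℤ) (unit-*-self s) ⟩
        0ℤ                     ∎
        where open ≈-Reasoning N

module Specialisation where

  open Congruence
  open PrimePowers
  open Lifting
  open import Data.Nat using (zero; suc; _*_; _^_; _≤_; s≤s; z≤n)
  open import Data.Nat.Base using (nonTrivial⇒≢1; nonTrivial⇒n>1)
  open import Data.Nat.Coprimality using (Coprime)
  open import Data.Nat.Divisibility
    using (_∣_; divides; ∣-refl; ∣-trans; ∣⇒≤; ∣1⇒≡1; *-cancelˡ-∣; m∣m*n; n∣m*n)
  open import Data.Nat.Primality using (Prime; euclidsLemma; prime⇒nonTrivial; prime[2])
  open import Data.Nat.Properties using (≤-antisym; m≤n⇒∃[o]m+o≡n; ^-distribˡ-+-*)
  open import Data.Nat.Tactic.RingSolver using (solve-∀)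
  open import Data.Integer as ℤ using (+_; 0ℤ)
  open import Data.Integer.Properties using (abs-*)
  import Data.Integer.Coprimality as ℤ
  open import Data.Product using (_,_; proj₁)
  open import Data.Sum using (inj₁; inj₂)
  open import Relation.Nullary using (¬_; contradiction)
  open import Relation.Binary.PropositionalEquality using (_≡_; _≢_; refl; trans; cong; subst)

  prime≢1 : ∀ {p} → Prime p → p ≢ 1
  prime≢1 p-prime = nonTrivial⇒≢1 {{prime⇒nonTrivial p-prime}}

  coprime-∣ʳ : ∀ {m n d} → Coprime m n → d ∣ n → Coprime m d
  coprime-∣ʳ m⊥n d∣n (c∣m , c∣d) = m⊥n (c∣m , ∣-trans c∣d d∣n)

  odd-prime∤2 : ∀ {p} → Prime p → ¬ 2 ∣ p → ¬ p ∣ 2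
  odd-prime∤2 {p} p-prime 2∤p p∣2 =
    2∤p (subst (2 ∣_) (≤-antisym (nonTrivial⇒n>1 p {{prime⇒nonTrivial p-prime}}) (∣⇒≤ p∣2)) ∣-refl)

  odd-prime∤2^n*m : ∀ {p m} → Prime p → ¬ 2 ∣ p → Coprime m p → ∀ n → ¬ p ∣ 2 ^ n * m
  odd-prime∤2^n*m {p} {m} p-prime 2∤p m⊥p n p∣2^n*m with euclidsLemma (2 ^ n) m p-prime p∣2^n*m
  ... | inj₁ p∣2^n = p∤2^n n p∣2^n
    where
    p∤2^n : ∀ n → ¬ p ∣ 2 ^ n
    p∤2^n zero p∣1 = prime≢1 p-prime (∣1⇒≡1 p∣1)
    p∤2^n (suc n) p∣2^[1+n] with euclidsLemma 2 (2 ^ n) p-prime p∣2^[1+n]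
    ... | inj₁ p∣2 = odd-prime∤2 p-prime 2∤p p∣2
    ... | inj₂ p∣2^n = p∤2^n n p∣2^n
  ... | inj₂ p∣m = prime≢1 p-prime (m⊥p (p∣m , ∣-refl))

  4∣2^n*m : ∀ {n} m → 2 ≤ n → 4 ∣ 2 ^ n * m
  4∣2^n*m {suc (suc n)} m (s≤s (s≤s z≤n)) = divides (2 ^ n * m) (regroup (2 ^ n) m)
    where
    regroup : ∀ x m → 2 * (2 * x) * m ≡ x * m * 4
    regroup = solve-∀

  2^b*p∣2^n*m*p^l : ∀ {b n} m p l → b ≤ n → 2 ^ b * p ∣ 2 ^ n * m * p ^ suc l
  2^b*p∣2^n*m*p^l {b} m p l b≤n with m≤n⇒∃[o]m+o≡n b≤n
  ... | t , refl = divides (2 ^ t * m * p ^ l)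
    (trans (cong (λ x → x * m * (p * p ^ l)) (^-distribˡ-+-* 2 b t)) (regroup (2 ^ b) (2 ^ t) m p (p ^ l)))
    where
    regroup : ∀ x y m p z → x * y * m * (p * z) ≡ y * m * z * (x * p)
    regroup = solve-∀

  2*coprime≉0[mod4] : ∀ {N} a → 2 ∣ N → ℤ.Coprime a (+ N) → ¬ (+ 2 ℤ.* a ≈ 0ℤ [mod 4 ])
  2*coprime≉0[mod4] a 2∣N a⊥N 4∣2a =
    prime≢1 prime[2] (a⊥N (*-cancelˡ-∣ 2 (subst (4 ∣_) (abs-* (+ 2) a) (≈0⇒∣ (+ 2 ℤ.* a) 4∣2a)) , 2∣N))

  2*coprime≉0[modp] : ∀ {N p} a → Prime p → ¬ 2 ∣ p → p ∣ N → ℤ.Coprime a (+ N) →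
                      ¬ (+ 2 ℤ.* a ≈ 0ℤ [mod p ])
  2*coprime≉0[modp] a p-prime 2∤p p∣N a⊥N p∣2a
    with euclidsLemma 2 ℤ.∣ a ∣ p-prime (subst (_ ∣_) (abs-* (+ 2) a) (≈0⇒∣ (+ 2 ℤ.* a) p∣2a))
  ... | inj₁ p∣2 = odd-prime∤2 p-prime 2∤p p∣2
  ... | inj₂ p∣a = prime≢1 p-prime (a⊥N (p∣a , p∣N))

  monomial-minimal-irreducible-2^n*m*p^l :
    ∀ {p m n b} l a → Prime p → ¬ 2 ∣ p → Coprime m p → 2 ≤ n → 2 ≤ b → b ≤ n →
    ℤ.Coprime a (+ (2 ^ n * m * p ^ suc l)) →
    MonomialMinimalIrreducible (2 ^ n * m) (+ 2 ℤ.* a) → MonomialMinimalIrreducible (2 ^ b * p) (+ 2 ℤ.* a) →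
    MonomialMinimalIrreducible (2 ^ n * m * p ^ suc l) (+ 2 ℤ.* a)
  monomial-minimal-irreducible-2^n*m*p^l {p} {m} {n} {b} l a p-prime 2∤p m⊥p 2≤n 2≤b b≤n a⊥N =
    monomial-minimal-irreducible-lift (suc l) (+ 2 ℤ.* a) p-prime (odd-prime∤2^n*m p-prime 2∤p m⊥p n)
      (n∣m*n (2 ^ b)) B∣N (4∣2^n*m m 2≤n) (4∣2^n*m p 2≤b) (λ ())
      (2*coprime≉0[mod4] a (∣-trans (divides 2 refl) (∣-trans (4∣2^n*m m 2≤n) (m∣m*n (p ^ suc l)))) a⊥N)
      (2*coprime≉0[modp] a p-prime 2∤p (∣-trans (n∣m*n (2 ^ b)) B∣N) a⊥N)
    where
    B∣N = 2^b*p∣2^n*m*p^l m p l b≤n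

  semi-monomially-irreducible-2^n*m*p^l :
    ∀ {p m n b} l → Prime p → ¬ 2 ∣ p → Coprime m p → 2 ≤ n → 2 ≤ b → b ≤ n →
    SemiMonomiallyIrreducible (2 ^ n * m) → SemiMonomiallyIrreducible (2 ^ b * p) →
    SemiMonomiallyIrreducible (2 ^ n * m * p ^ suc l)
  semi-monomially-irreducible-2^n*m*p^l {p} {m} {n} {b} l p-prime 2∤p m⊥p 2≤n 2≤b b≤n semi₁ semi₂ =
    (λ _ a a⊥N → monomial-minimal-irreducible-2^n*m*p^l l a p-prime 2∤p m⊥p 2≤n 2≤b b≤n a⊥N
                   (proj₁ semi₁ (inj₂ (4∣2^n*m m 2≤n)) a (coprime-∣ʳ a⊥N A∣N))
                   (proj₁ semi₂ (inj₂ (4∣2^n*m p 2≤b)) a (coprime-∣ʳ a⊥N (2^b*p∣2^n*m*p^l m p l b≤n)))) ,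
    λ (_ , 4∤N) → contradiction (∣-trans (4∣2^n*m m 2≤n) A∣N) 4∤N
    where
    A∣N = m∣m*n (p ^ suc l)

open import Data.Nat using (ℕ; _≤_; _^_; _*_)
open import Data.Nat.Divisibility using (_∣_)
open import Data.Nat.Primality using (Prime)
open import Data.Nat.Coprimality as ℕC using ()
open import Data.Integer as ℤ using (ℤ; +_)
open import Data.Integer.Coprimality as ℤC using ()
open import Data.Product using (Σ; _×_)
open import Relation.Nullary using (¬_)

open Specialisation
open import Data.Nat using (zero; suc)
open import Data.Nat.Properties using (*-identityʳ)
open import Data.Product using (_,_)
open import Relation.Binary.PropositionalEquality using (subst; sym)

mainTheorem12 :
    (p l m n : ℕ) → Prime p → ¬ (2 ∣ p) → 1 ≤ m → ¬ (2 ∣ m) → ℕC.Coprime m p → 2 ≤ n →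
    ((a : ℤ) → ℤC.Coprime a (+ (2 ^ n * m * p ^ l)) →
       MonomialMinimalIrreducible (2 ^ n * m) (+ 2 ℤ.* a) →
       Σ ℕ (λ b → 2 ≤ b × b ≤ n × MonomialMinimalIrreducible (2 ^ b * p) (+ 2 ℤ.* a)) →
       MonomialMinimalIrreducible (2 ^ n * m * p ^ l) (+ 2 ℤ.* a))
    ×
    (Σ ℕ (λ b → 2 ≤ b × b ≤ n × SemiMonomiallyIrreducible (2 ^ n * m) × SemiMonomiallyIrreducible (2 ^ b * p)) →
       SemiMonomiallyIrreducible (2 ^ n * m * p ^ l))
mainTheorem12 p zero m n _ _ _ _ _ _ =
  (λ a _ irr₁ _ → subst (λ N → MonomialMinimalIrreducible N (+ 2 ℤ.* a)) (sym (*-identityʳ (2 ^ n * m))) irr₁) ,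
  (λ (_ , _ , _ , semi₁ , _) → subst SemiMonomiallyIrreducible (sym (*-identityʳ (2 ^ n * m))) semi₁)
mainTheorem12 p (suc l) m n p-prime 2∤p _ _ m⊥p 2≤n =
  (λ a a⊥N irr₁ (b , 2≤b , b≤n , irr₂) →
     monomial-minimal-irreducible-2^n*m*p^l l a p-prime 2∤p m⊥p 2≤n 2≤b b≤n a⊥N irr₁ irr₂) ,
  (λ (b , 2≤b , b≤n , semi₁ , semi₂) →
     semi-monomially-irreducible-2^n*m*p^l l p-prime 2∤p m⊥p 2≤n 2≤b b≤n semi₁ semi₂)
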